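{- Let $G = P_m \,\square\, P_n$ be a two-dimensional grid, where $m,n \ge 1$, and let $\Sigma \subseteq E(G)$ be an arbitrary set of edges. Then there exists a signified homomorphism $h:(G,\Sigma)\to SP_9$.
   Context: A signified graph is a pair $(G,\Sigma)$ where $G$ is an undirected graph and $\Sigma\subseteq E(G)$ is the set of edges signed '$-$'; all other edges are signed '$+$'. A signified homomorphism $h:(G,\Sigma)\to(H,\Lambda)$ is a map $h:V(G)\to V(H)$ such that for every edge $\{u,v\}\in E(G)$, $\{h(u),h(v)\}$ is an edge of $H$ (in particular $h(u)\neq h(v)$) and it has the same sign in $(H,\Lambda)$ as $\{u,v\}$ has in $(G,\Sigma)$. A (2-dimensional) grid is the Cartesian product $P_m\,\square\,P_n$ of two paths. Let $\mathbb{F}_9=GF(3)[x]/(x^2+1)$ be the field with 9 elements; its nonzero squares are $1,2,x,2x$. The signified Paley graph $SP_9$ is the signified graph whose underlying graph is the complete graph $K_9$ on vertex set $\mathbb{F}_9$, where an edge $\{a,b\}$ is signed '$+$' if $b-a$ is a nonzero square in $\mathbb{F}_9$ and '$-$' otherwise (this is well defined since $-1$ is a square in $\mathbb{F}_9$). -}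

module Defs where

open import Data.Nat using (ℕ; suc)
open import Data.Fin using (Fin; toℕ)
open import Data.Bool using (Bool; true; false)
open import Data.Product using (_×_; Σ; ∃; _,_)
open import Data.Sum using (_⊎_)
open import Relation.Binary.PropositionalEquality using (_≡_; _≢_)
open import Relation.Nullary using (¬_)

data 𝔽₃ : Set where
  0₃ 1₃ 2₃ : 𝔽₃

_+₃_ : 𝔽₃ → 𝔽₃ → 𝔽₃
0₃ +₃ y = y
1₃ +₃ 0₃ = 1₃
1₃ +₃ 1₃ = 2₃
1₃ +₃ 2₃ = 0₃
2₃ +₃ 0₃ = 2₃
2₃ +₃ 1₃ = 0₃
2₃ +₃ 2₃ = 1₃

-₃_ : 𝔽₃ → 𝔽₃
-₃ 0₃ = 0₃
-₃ 1₃ = 2₃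
-₃ 2₃ = 1₃

_*₃_ : 𝔽₃ → 𝔽₃ → 𝔽₃
0₃ *₃ y = 0₃
1₃ *₃ y = y
2₃ *₃ y = -₃ y

-- 𝔽₉ = GF(3)[x]/(x²+1); the pair (a , b) stands for a + b·x

𝔽₉ : Set
𝔽₉ = 𝔽₃ × 𝔽₃

0₉ : 𝔽₉
0₉ = 0₃ , 0₃

_-₉_ : 𝔽₉ → 𝔽₉ → 𝔽₉
(a , b) -₉ (c , d) = (a +₃ (-₃ c)) , (b +₃ (-₃ d))

-- (a + b x)(c + d x) = (ac - bd) + (ad + bc) x   since x² = -1
_*₉_ : 𝔽₉ → 𝔽₉ → 𝔽₉
(a , b) *₉ (c , d) = ((a *₃ c) +₃ (-₃ (b *₃ d))) , ((a *₃ d) +₃ (b *₃ c))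

NonzeroSquare : 𝔽₉ → Set
NonzeroSquare d = d ≢ 0₉ × ∃ λ y → y *₉ y ≡ d

-- The signified Paley graph SP₉: complete graph on 𝔽₉,
-- edge {a,b} (a ≢ b) is '+' iff b - a is a nonzero square, '-' otherwise.
-- A sign is a Bool: true = '-' (edge in Σ), false = '+'.

SP₉-negative : 𝔽₉ → 𝔽₉ → Set
SP₉-negative a b = ¬ NonzeroSquare (b -₉ a)

SP₉-positive : 𝔽₉ → 𝔽₉ → Set
SP₉-positive a b = NonzeroSquare (b -₉ a)

-- The grid P_m □ P_n, vertices Fin m × Fin n.
-- Each (unordered) edge is represented exactly once, oriented from the
-- vertex with the smaller coordinate to the larger one.

GridVertex : ℕ → ℕ → Set
GridVertex m n = Fin m × Fin n

GridEdge : {m n : ℕ} → GridVertex m n → GridVertex m n → Set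
GridEdge (i , j) (i' , j') =
  (i ≡ i' × toℕ j' ≡ suc (toℕ j)) ⊎ (j ≡ j' × toℕ i' ≡ suc (toℕ i))

-- A signature Σ ⊆ E(G) of the grid: σ u v ≡ true means the edge u→v
-- (whenever GridEdge u v) is signed '-'.  Values on non-edges are irrelevant.
GridSignature : ℕ → ℕ → Set
GridSignature m n = GridVertex m n → GridVertex m n → Bool

IsSignifiedHom : {m n : ℕ} → GridSignature m n → (GridVertex m n → 𝔽₉) → Set
IsSignifiedHom {m} {n} σ h =
  (u v : GridVertex m n) → GridEdge u v →
    (h u ≢ h v)
    × (σ u v ≡ true → SP₉-negative (h u) (h v))
    × (σ u v ≡ false → SP₉-positive (h u) (h v))

-- The homomorphism is built row by row.  The property of SP₉ that makes this
-- work, checked exhaustively, is pair extension: for distinct p, q, any r and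
-- any signs s, t, at least two distinct vertices are joined to r with sign s
-- and to p or q with sign t.  One colour per column would not do, since the
-- left and upper neighbours of a vertex may share a colour and demand opposite
-- signs.  So a forward pass keeps two candidates per column, each fitting the
-- vertex above and one candidate on its left, and a backward pass fixes the
-- colours from right to left, choosing at each column the candidate joined to
-- the colour already chosen on its right.

module Submission where

open import Defs
open import Data.Bool using (Bool; true; false)
open import Data.Bool.Properties using () renaming (_≟_ to _≟ᵇ_)
open import Data.Fin using (Fin; toℕ)
open import Data.Fin.Properties using (toℕ<n; toℕ-fromℕ<; toℕ-injective)
open import Data.List using (List; []; _∷_; cartesianProduct)
open import Data.List.Membership.Propositional using (_∈_; lose)
open import Data.List.Membership.Propositional.Properties using (∈-cartesianProduct⁺)
open import Data.List.Relation.Unary.All using (all?; lookup; tabulate)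
open import Data.List.Relation.Unary.Any using (here; there; any?; satisfied)
open import Data.Nat using (ℕ; zero; suc; _∸_; _<_; _≤_; NonZero; >-nonZero)
open import Data.Nat.DivMod using (_mod_; m<n⇒m%n≡m)
open import Data.Nat.Properties using (+-∸-assoc)
open import Data.Product using (∃; ∃₂; _×_; _,_; proj₁; proj₂)
open import Data.Product.Properties using (≡-dec)
open import Data.Sum using (_⊎_; inj₁; inj₂)
open import Function using (_∘_)
open import Relation.Binary.Definitions using (DecidableEquality)
open import Relation.Binary.PropositionalEquality using (_≡_; _≢_; refl; trans; subst)
open import Relation.Nullary using (Dec; yes; no; ¬?; _×-dec_; _⊎-dec_; _→-dec_; contradiction)
open import Relation.Nullary.Decidable using (map′; from-yes; from-no)
open import Relation.Unary using (Decidable)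

module GridColouring {V : Set} (Joined : V → V → Bool → Set) where

  record DistinctPair : Set where
    constructor pair
    field
      fst snd : V
      fst≢snd : fst ≢ snd

  open DistinctPair

  _∈ₚ_ : V → DistinctPair → Set
  c ∈ₚ P = c ≡ fst P ⊎ c ≡ snd P

  Fits : V → Bool → V → V → Bool → V → Set
  Fits r s p q t c = Joined r c s × (Joined p c t ⊎ Joined q c t)

  HasPairExtension : Set
  HasPairExtension = ∀ {p q} → p ≢ q → ∀ r s t →
    ∃₂ λ c c' → c ≢ c' × Fits r s p q t c × Fits r s p q t c'

  module _ (Joined? : ∀ a c s → Dec (Joined a c s)) (extension : HasPairExtension)
           (start : DistinctPair) where

    extend : DistinctPair → V → Bool → Bool → DistinctPair
    extend P r s t with extension (fst≢snd P) r s t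
    ... | c , c' , c≢c' , _ = pair c c' c≢c'

    extend-fits : ∀ P r s t {c} → c ∈ₚ extend P r s t → Fits r s (fst P) (snd P) t c
    extend-fits P r s t c∈ with extension (fst≢snd P) r s t
    extend-fits P r s t (inj₁ refl) | _ , _ , _ , fits , _ = fits
    extend-fits P r s t (inj₂ refl) | _ , _ , _ , _ , fits = fits

    predecessor : DistinctPair → Bool → V → V
    predecessor P t c with Joined? (fst P) c t
    ... | yes _ = fst P
    ... | no _ = snd P

    predecessor-∈ : ∀ P t c → predecessor P t c ∈ₚ P
    predecessor-∈ P t c with Joined? (fst P) c t
    ... | yes _ = inj₁ refl
    ... | no _ = inj₂ refl

    predecessor-joined : ∀ P t c → Joined (fst P) c t ⊎ Joined (snd P) c t →
                         Joined (predecessor P t c) c t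
    predecessor-joined P t c joined with Joined? (fst P) c t | joined
    ... | yes j | _ = j
    ... | no ¬j | inj₁ j = contradiction j ¬j
    ... | no _ | inj₂ j = j

    module Row (n : ℕ) (above : ℕ → V) (vertical horizontal : ℕ → Bool) where

      candidates : ℕ → DistinctPair
      candidates zero = extend start (above zero) (vertical zero) false
      candidates (suc j) = extend (candidates j) (above (suc j)) (vertical (suc j)) (horizontal j)

      candidate-below : ∀ j {c} → c ∈ₚ candidates j → Joined (above j) c (vertical j)
      candidate-below zero c∈ = proj₁ (extend-fits _ _ _ _ c∈)
      candidate-below (suc j) c∈ = proj₁ (extend-fits _ _ _ _ c∈)

      candidate-after : ∀ j {c} → c ∈ₚ candidates (suc j) →
        Joined (fst (candidates j)) c (horizontal j) ⊎ Joined (snd (candidates j)) c (horizontal j)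
      candidate-after j c∈ = proj₂ (extend-fits _ _ _ _ c∈)

      -- entry d j is column j of the row that stops at column j + d.
      entry : ℕ → ℕ → V
      entry zero j = fst (candidates j)
      entry (suc d) j = predecessor (candidates j) (horizontal j) (entry d (suc j))

      entry-∈ : ∀ d j → entry d j ∈ₚ candidates j
      entry-∈ zero j = inj₁ refl
      entry-∈ (suc d) j = predecessor-∈ _ _ _

      row : ℕ → V
      row j = entry (n ∸ suc j) j

      row-below : ∀ j → Joined (above j) (row j) (vertical j)
      row-below j = candidate-below j (entry-∈ (n ∸ suc j) j)

      row-along : ∀ j → suc j < n → Joined (row j) (row (suc j)) (horizontal j)
      row-along j j+1<n rewrite +-∸-assoc 1 j+1<n =
        predecessor-joined _ _ _ (candidate-after j (entry-∈ (n ∸ suc (suc j)) (suc j)))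

    module Grid (n : ℕ) (sign : ℕ × ℕ → ℕ × ℕ → Bool) where

      private
        horizontal vertical : ℕ → ℕ → Bool
        horizontal i j = sign (i , j) (i , suc j)
        vertical i j = sign (i , j) (suc i , j)

        -- Row 0 is placed below a virtual constant row; the pair extension
        -- property holds for every vertex above, so this costs nothing.
        rows : ℕ → ℕ → V
        rows zero = Row.row n (λ _ → fst start) (λ _ → false) (horizontal zero)
        rows (suc i) = Row.row n (rows i) (vertical i) (horizontal (suc i))

      colour : ℕ × ℕ → V
      colour (i , j) = rows i j

      colour-along : ∀ i j → suc j < n →
        Joined (colour (i , j)) (colour (i , suc j)) (sign (i , j) (i , suc j))
      colour-along zero = Row.row-along n _ _ _
      colour-along (suc i) = Row.row-along n _ _ _

      colour-below : ∀ i j → Joined (colour (i , j)) (colour (suc i , j)) (sign (i , j) (suc i , j))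
      colour-below i = Row.row-below n (rows i) _ _

module _ {A : Set} {xs : List A} (complete : ∀ x → x ∈ xs) {P : A → Set} (P? : Decidable P) where

  ∀-dec : Dec (∀ x → P x)
  ∀-dec = map′ (λ all x → lookup all (complete x)) (λ f → tabulate λ {x} _ → f x) (all? P? xs)

  ∃-dec : Dec (∃ P)
  ∃-dec = map′ satisfied (λ (x , px) → lose (complete x) px) (any? P? xs)

_≟₃_ : DecidableEquality 𝔽₃
0₃ ≟₃ 0₃ = yes refl
1₃ ≟₃ 1₃ = yes refl
2₃ ≟₃ 2₃ = yes refl
0₃ ≟₃ 1₃ = no λ ()
0₃ ≟₃ 2₃ = no λ ()
1₃ ≟₃ 0₃ = no λ ()
1₃ ≟₃ 2₃ = no λ ()
2₃ ≟₃ 0₃ = no λ ()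
2₃ ≟₃ 1₃ = no λ ()

_≟₉_ : DecidableEquality 𝔽₉
_≟₉_ = ≡-dec _≟₃_ _≟₃_

all𝔽₃ : List 𝔽₃
all𝔽₃ = 0₃ ∷ 1₃ ∷ 2₃ ∷ []

∈-all𝔽₃ : ∀ a → a ∈ all𝔽₃
∈-all𝔽₃ 0₃ = here refl
∈-all𝔽₃ 1₃ = there (here refl)
∈-all𝔽₃ 2₃ = there (there (here refl))

all𝔽₉ : List 𝔽₉
all𝔽₉ = cartesianProduct all𝔽₃ all𝔽₃

∈-all𝔽₉ : ∀ a → a ∈ all𝔽₉
∈-all𝔽₉ (a , b) = ∈-cartesianProduct⁺ (∈-all𝔽₃ a) (∈-all𝔽₃ b)

∈-allBool : ∀ b → b ∈ true ∷ false ∷ []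
∈-allBool true = here refl
∈-allBool false = there (here refl)

squareRoot? : ∀ d → Dec (∃ λ y → y *₉ y ≡ d)
squareRoot? d = ∃-dec ∈-all𝔽₉ λ y → (y *₉ y) ≟₉ d

-- Listing the squares 1, 2, x, 2x keeps the exhaustive check below fast.
nonzeroSquare? : Decidable NonzeroSquare
nonzeroSquare? (0₃ , 0₃) = no λ (0≢0 , _) → 0≢0 refl
nonzeroSquare? (1₃ , 0₃) = yes ((λ ()) , (1₃ , 0₃) , refl)
nonzeroSquare? (2₃ , 0₃) = yes ((λ ()) , (0₃ , 1₃) , refl)
nonzeroSquare? (0₃ , 1₃) = yes ((λ ()) , (1₃ , 2₃) , refl)
nonzeroSquare? (0₃ , 2₃) = yes ((λ ()) , (1₃ , 1₃) , refl)
nonzeroSquare? (1₃ , 1₃) = no λ (_ , root) → from-no (squareRoot? (1₃ , 1₃)) root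
nonzeroSquare? (1₃ , 2₃) = no λ (_ , root) → from-no (squareRoot? (1₃ , 2₃)) root
nonzeroSquare? (2₃ , 1₃) = no λ (_ , root) → from-no (squareRoot? (2₃ , 1₃)) root
nonzeroSquare? (2₃ , 2₃) = no λ (_ , root) → from-no (squareRoot? (2₃ , 2₃)) root

SP₉-Joined : 𝔽₉ → 𝔽₉ → Bool → Set
SP₉-Joined a c s = (a ≢ c) × (s ≡ true → SP₉-negative a c) × (s ≡ false → SP₉-positive a c)

SP₉-Joined? : ∀ a c s → Dec (SP₉-Joined a c s)
SP₉-Joined? a c s =
  ¬? (a ≟₉ c) ×-dec
  (s ≟ᵇ true →-dec ¬? (nonzeroSquare? (c -₉ a))) ×-dec
  (s ≟ᵇ false →-dec nonzeroSquare? (c -₉ a))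

open GridColouring SP₉-Joined

-- Opaque, so that normalising a goal that mentions the colouring does not
-- rerun the search.
opaque
  SP₉-pairExtension : HasPairExtension
  SP₉-pairExtension {p} {q} = from-yes search p q
    where
    fits? : ∀ r s p q t c → Dec (Fits r s p q t c)
    fits? r s p q t c = SP₉-Joined? r c s ×-dec (SP₉-Joined? p c t ⊎-dec SP₉-Joined? q c t)

    search : Dec (∀ p q → p ≢ q → ∀ r s t →
                  ∃₂ λ c c' → c ≢ c' × Fits r s p q t c × Fits r s p q t c')
    search =
      ∀-dec ∈-all𝔽₉ λ p → ∀-dec ∈-all𝔽₉ λ q → ¬? (p ≟₉ q) →-dec
      ∀-dec ∈-all𝔽₉ λ r → ∀-dec ∈-allBool λ s → ∀-dec ∈-allBool λ t →
      ∃-dec ∈-all𝔽₉ λ c → ∃-dec ∈-all𝔽₉ λ c' →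
      ¬? (c ≟₉ c') ×-dec fits? r s p q t c ×-dec fits? r s p q t c'

toℕ-mod : ∀ {k} .{{_ : NonZero k}} (i : Fin k) → toℕ i mod k ≡ i
toℕ-mod i = toℕ-injective (trans (toℕ-fromℕ< _) (m<n⇒m%n≡m (toℕ<n i)))

gridHomomorphism : ∀ {m n} .{{_ : NonZero m}} .{{_ : NonZero n}} (σ : GridSignature m n) →
  ∃ λ (h : GridVertex m n → 𝔽₉) → IsSignifiedHom σ h
gridHomomorphism {m} {n} σ =
  colour ∘ toℕ² , λ u v uv → subst (SP₉-Joined _ _) (sign-toℕ² u v) (joined u v uv)
  where
  sign : ℕ × ℕ → ℕ × ℕ → Bool
  sign (a , b) (a' , b') = σ (a mod m , b mod n) (a' mod m , b' mod n)

  open Grid SP₉-Joined? SP₉-pairExtension (pair (0₃ , 0₃) (1₃ , 0₃) λ ()) n sign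

  toℕ² : GridVertex m n → ℕ × ℕ
  toℕ² (i , j) = toℕ i , toℕ j

  sign-toℕ² : ∀ u v → sign (toℕ² u) (toℕ² v) ≡ σ u v
  sign-toℕ² (i , j) (i' , j') rewrite toℕ-mod i | toℕ-mod j | toℕ-mod i' | toℕ-mod j' = refl

  joined : ∀ u v → GridEdge u v →
    SP₉-Joined (colour (toℕ² u)) (colour (toℕ² v)) (sign (toℕ² u) (toℕ² v))
  joined (i , j) (.i , j') (inj₁ (refl , j'≡1+j)) rewrite j'≡1+j =
    colour-along (toℕ i) (toℕ j) (subst (_< n) j'≡1+j (toℕ<n j'))
  joined (i , j) (i' , .j) (inj₂ (refl , i'≡1+i)) rewrite i'≡1+i = colour-below (toℕ i) (toℕ j)

theorem1 : (m n : ℕ) → 1 ≤ m → 1 ≤ n → (σ : GridSignature m n) →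
    ∃ λ (h : GridVertex m n → 𝔽₉) → IsSignifiedHom σ h
theorem1 m n 1≤m 1≤n = gridHomomorphism {{>-nonZero 1≤m}} {{>-nonZero 1≤n}}
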